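{- Let $a,b,c$ be integers with $a\ge b$, and let ${\mathscr O}(a,b,c)$ be the set of $(x,y)\in\mathbb{Z}^2$ with $0\le x\le a$, $0\le y\le b$, $c\le x+y\le a+b-c$, $c-b\le x-y\le a-c$, where each of these eight inequalities holds with equality for at least one point of ${\mathscr O}(a,b,c)$. Then the maximum of $d_4(z_1,z_2,z_3,z_4)$ over $z_1,z_2,z_3,z_4\in{\mathscr O}(a,b,c)$ equals $a+2b-2c$.
   Context: The grid graph ${\cal G}_2$ has vertex set $\mathbb{Z}^2$, with $z,z'$ adjacent iff their $L_1$-distance is $1$. The quadristance $d_4(z_1,z_2,z_3,z_4)$ of points of $\mathbb{Z}^2$ is the minimum number of edges of a tree in ${\cal G}_2$ (possibly using additional vertices) containing $z_1,z_2,z_3,z_4$. -}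

module Defs where

open import Data.Nat using (ℕ; zero; suc)
open import Data.Integer using (ℤ; +_; _+_; _-_; _≤_; ∣_∣)
open import Data.Product using (_×_; _,_; Σ; ∃; ∃-syntax)
open import Data.List using (List; []; _∷_; [_])
open import Data.List.Membership.Propositional using (_∈_; _∉_)
open import Relation.Binary.PropositionalEquality using (_≡_)

Pt : Set
Pt = ℤ × ℤ

Adj : Pt → Pt → Set
Adj (x , y) (x' , y') = ∣ x - x' ∣ Data.Nat.+ ∣ y - y' ∣ ≡ 1

-- GridTree V n : V is the vertex list of the tree, n its number of edges.
data GridTree : List Pt → ℕ → Set where
  single : (v : Pt) → GridTree [ v ] zero
  grow   : {V : List Pt} {n : ℕ} (u w : Pt) → u ∈ V → w ∉ V → Adj u w →
           GridTree V n → GridTree (w ∷ V) (suc n)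

TreeThrough : Pt → Pt → Pt → Pt → ℕ → Set
TreeThrough z₁ z₂ z₃ z₄ n =
  Σ (List Pt) λ V → GridTree V n × (z₁ ∈ V × z₂ ∈ V × z₃ ∈ V × z₄ ∈ V)

-- d₄(z₁,z₂,z₃,z₄) = m : m is the minimum number of edges of such a tree
IsQuadristance : Pt → Pt → Pt → Pt → ℕ → Set
IsQuadristance z₁ z₂ z₃ z₄ m =
  TreeThrough z₁ z₂ z₃ z₄ m × (∀ n → TreeThrough z₁ z₂ z₃ z₄ n → m Data.Nat.≤ n)

InO : ℤ → ℤ → ℤ → Pt → Set
InO a b c (x , y) =
  (+ 0 ≤ x) × (x ≤ a) × (+ 0 ≤ y) × (y ≤ b) ×
  (c ≤ x + y) × (x + y ≤ (a + b) - c) ×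
  ((c - b) ≤ x - y) × (x - y ≤ a - c)

AllTight : ℤ → ℤ → ℤ → Set
AllTight a b c =
  (∃[ p ] InO a b c p × Data.Product.proj₁ p ≡ + 0) ×
  (∃[ p ] InO a b c p × Data.Product.proj₁ p ≡ a) ×
  (∃[ p ] InO a b c p × Data.Product.proj₂ p ≡ + 0) ×
  (∃[ p ] InO a b c p × Data.Product.proj₂ p ≡ b) ×
  (∃[ p ] InO a b c p × Data.Product.proj₁ p + Data.Product.proj₂ p ≡ c) ×
  (∃[ p ] InO a b c p × Data.Product.proj₁ p + Data.Product.proj₂ p ≡ (a + b) - c) ×
  (∃[ p ] InO a b c p × Data.Product.proj₁ p - Data.Product.proj₂ p ≡ c - b) ×
  (∃[ p ] InO a b c p × Data.Product.proj₁ p - Data.Product.proj₂ p ≡ a - c)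

-- Join every point to the horizontal trunk from (c , h) to (a - c , h) by an
-- L-shaped leg that first runs horizontally into the trunk's range of x. Each of the octagon's
-- inequalities bounds one kind of leg: a point below the trunk needs at most h edges, a point
-- above it at most b - h. If h + h ≤ b ≤ h + h + 1, every point lies below the trunk at height
-- b - h or above the one at height h, so the trees built on these two trunks have at most
-- 2 (a - 2c) + 4b edges together and the smaller one has at most a + 2b - 2c.
--
-- Take P₁ = (0 , c), P₂ = (c , b), P₃ = (a , b - c) and P₄ = (a - c , 0). A tree
-- through them crosses every line x = i + ½ (0 ≤ i < a), which separates P₁ from P₃, and every
-- line y = j + ½ (0 ≤ j < b), which separates P₄ from P₂, while a grid edge crosses at most one
-- of these lines. Around a point (i + ½ , j + ½) of the inner square c ≤ i < a - c, c ≤ j < b - c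
-- the four points lie in four different quadrants, so the tree crosses the two lines through it
-- at least three times. Hence all inner vertical lines or all inner horizontal lines are crossed
-- twice, and the tree has at least a + b + (b - 2c) edges.

module Submission where

open import Defs
open import Data.Bool using (Bool; true; false; if_then_else_)
open import Data.Bool.Instances
open import Data.Empty using (⊥-elim)
open import Data.Integer
  using (ℤ; +_; _+_; _-_; _*_; -_; _≤_; _<_; ∣_∣; _⊓_; _≤?_; 0ℤ; 1ℤ; -1ℤ; +≤+; +<+)
open import Data.Integer.DivMod using (_/_; _%_; a≡a%n+[a/n]*n; n%d<d)
import Data.Integer.Properties as ℤ
open import Data.Integer.Tactic.RingSolver using (solve)
open import Data.List using (List; []; _∷_; [_]; length; map; filter)
open import Data.List.Membership.Propositional using (_∈_)
open import Data.List.Membership.Propositional.Properties using (∈-map⁺)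
open import Data.List.Properties using (filter-accept; filter-reject; filter-all)
open import Data.List.Relation.Unary.All using (All)
import Data.List.Relation.Unary.All as All
import Data.List.Relation.Unary.All.Properties as All
import Data.List.Relation.Unary.AllPairs
open import Data.List.Relation.Unary.Any using (here; there)
open import Data.List.Relation.Unary.Unique.Propositional using (Unique)
import Data.List.Relation.Unary.Unique.Propositional.Properties as Unique
open import Data.Nat as ℕ using (ℕ; zero; suc; z≤n; s≤s)
import Data.Nat.Properties as ℕ
open import Algebra.Properties.CommutativeSemigroup ℕ.+-commutativeSemigroup
  using () renaming (interchange to +-interchange)
import Data.Nat.Tactic.RingSolver as ℕ-Solver
open import Data.Product using (_×_; _,_; ∃-syntax; proj₁; proj₂)
open import Data.Product.Instances
open import Data.Product.Properties using (≡-dec)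
open import Data.Sum using (_⊎_; inj₁; inj₂)
open import Function using (_∘_; id)
open import Level using (0ℓ)
open import Relation.Binary.PropositionalEquality
  using (_≡_; _≢_; refl; sym; trans; cong; cong₂; subst; subst₂)
open import Relation.Binary.Structures using (IsDecEquivalence)
open import Relation.Nullary using (Dec; yes; no; ¬?; does)
open import Relation.Nullary.Decidable using (dec-true; dec-false)
open import Relation.Unary using (Pred; _⊆_; _∪_; ｛_｝)
open import Data.List.Membership.DecPropositional (≡-dec ℤ._≟_ ℤ._≟_) using (_∈?_)

≤-via : ∀ {u v l r : ℤ} → u ≤ v → r - l ≡ v - u → l ≤ r
≤-via u≤v eq = ℤ.0≤i-j⇒j≤i (subst (0ℤ ≤_) (sym eq) (ℤ.i≤j⇒0≤j-i u≤v))

half-≤ : ∀ {i j : ℤ} → i + i ≤ j + j → i ≤ j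
half-≤ i+i≤j+j = ℤ.≮⇒≥ (λ j<i → ℤ.<⇒≱ (ℤ.+-mono-< j<i j<i) i+i≤j+j)

+∣j-i∣≡j-i : ∀ {i j} → i ≤ j → + ∣ j - i ∣ ≡ j - i
+∣j-i∣≡j-i i≤j = ℤ.0≤i⇒+∣i∣≡i (ℤ.i≤j⇒0≤j-i i≤j)

+∣i-j∣≡j-i : ∀ {i j} → i ≤ j → + ∣ i - j ∣ ≡ j - i
+∣i-j∣≡j-i {i} {j} i≤j = trans (cong +_ (ℤ.∣i-j∣≡∣j-i∣ i j)) (+∣j-i∣≡j-i i≤j)

halving : ∀ b → ∃[ h ] h + h ≤ b × b ≤ h + h + 1ℤ
halving b =
  h , subst (h + h ≤_) (sym b≡) (proj₁ bounds) , subst (_≤ h + h + 1ℤ) (sym b≡) (proj₂ bounds)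
  where
    h = b / + 2
    b≡ : b ≡ + (b % + 2) + h * + 2
    b≡ = a≡a%n+[a/n]*n b (+ 2)
    between : ∀ ρ h → 0ℤ ≤ ρ → ρ ≤ 1ℤ → h + h ≤ ρ + h * + 2 × ρ + h * + 2 ≤ h + h + 1ℤ
    between ρ h 0≤ρ ρ≤1 = ≤-via 0≤ρ (solve (ρ ∷ h ∷ [])) , ≤-via ρ≤1 (solve (ρ ∷ h ∷ []))
    bounds = between (+ (b % + 2)) h (+≤+ z≤n) (+≤+ (ℕ.s≤s⁻¹ (n%d<d b (+ 2))))

d₁ : Pt → Pt → ℕ
d₁ (x , y) (x' , y') = ∣ x - x' ∣ ℕ.+ ∣ y - y' ∣

Spans : Pred Pt 0ℓ → ℤ → Set
Spans P k = ∃[ V ] ∃[ n ] GridTree V n × P ⊆ (_∈ V) × + n ≤ k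

spans-mono : ∀ {P Q : Pred Pt 0ℓ} {k l} → Q ⊆ P → k ≤ l → Spans P k → Spans Q l
spans-mono Q⊆P k≤l (V , n , T , P⊆V , n≤k) = V , n , T , P⊆V ∘ Q⊆P , ℤ.≤-trans n≤k k≤l

spans-singleton : ∀ p → Spans ｛ p ｝ 0ℤ
spans-singleton p = [ p ] , 0 , single p , (λ { refl → here refl }) , ℤ.≤-refl

spans-step : ∀ {P k p q} → Spans P k → P p → Adj p q → Spans (P ∪ ｛ q ｝) (+ 1 + k)
spans-step {q = q} (V , n , T , P⊆V , n≤k) Pp adj with q ∈? V
... | yes q∈V = V , n , T , (λ { (inj₁ Pr) → P⊆V Pr ; (inj₂ refl) → q∈V }) ,
                ℤ.≤-trans n≤k (ℤ.i≤j+i _ (+ 1))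
... | no q∉V  = q ∷ V , suc n , grow _ q (P⊆V Pp) q∉V adj T ,
                (λ { (inj₁ Pr) → there (P⊆V Pr) ; (inj₂ refl) → here refl }) , ℤ.+-monoʳ-≤ (+ 1) n≤k

along : Pt → Pt → ℕ → Pt
along (x , y) (dx , dy) i = (x + + i * dx , y + + i * dy)

Ray : Pt → Pt → ℕ → Pred Pt 0ℓ
Ray p d n q = ∃[ i ] i ℕ.≤ n × along p d i ≡ q

adj-along : ∀ p d i → ∣ proj₁ d ∣ ℕ.+ ∣ proj₂ d ∣ ≡ 1 → Adj (along p d i) (along p d (suc i))
adj-along (x , y) (dx , dy) i unit = trans (cong₂ ℕ._+_ (step x dx) (step y dy)) unit
  where
    back : ∀ z t dz → (z + t * dz) - (z + (+ 1 + t) * dz) ≡ - dz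
    back z t dz = solve (z ∷ t ∷ dz ∷ [])
    step : ∀ z dz → ∣ (z + + i * dz) - (z + + suc i * dz) ∣ ≡ ∣ dz ∣
    step z dz = trans (cong ∣_∣ (back z (+ i) dz)) (ℤ.∣-i∣≡∣i∣ dz)

spans-ray : ∀ {P k} p d → ∣ proj₁ d ∣ ℕ.+ ∣ proj₂ d ∣ ≡ 1 → Spans P k → P p →
            ∀ n → Spans (P ∪ Ray p d n) (k + + n)
spans-ray {P} {k} p d unit sp Pp zero =
  spans-mono (λ { (inj₁ Pq) → Pq ; (inj₂ (0 , z≤n , refl)) → subst P (sym (along-zero p d)) Pp })
             (ℤ.≤-reflexive (sym (ℤ.+-identityʳ k))) sp
  where
    along-zero : ∀ p d → along p d 0 ≡ p
    along-zero (x , y) _ = cong₂ _,_ (ℤ.+-identityʳ x) (ℤ.+-identityʳ y)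
spans-ray {P} {k} p d unit sp Pp (suc n) =
  spans-mono extend (ℤ.≤-reflexive (shift k (+ n)))
    (spans-step (spans-ray p d unit sp Pp n) (inj₂ (n , ℕ.≤-refl , refl)) (adj-along p d n unit))
  where
    extend : P ∪ Ray p d (suc n) ⊆ (P ∪ Ray p d n) ∪ ｛ along p d (suc n) ｝
    extend (inj₁ Pq) = inj₁ (inj₁ Pq)
    extend (inj₂ (i , i≤1+n , refl)) with ℕ.m≤n⇒m<n∨m≡n i≤1+n
    ... | inj₁ i<1+n = inj₁ (inj₂ (i , ℕ.s≤s⁻¹ i<1+n , refl))
    ... | inj₂ refl  = inj₂ refl
    shift : ∀ k t → + 1 + (k + t) ≡ k + (+ 1 + t)
    shift k t = solve (k ∷ t ∷ [])

spans-segment : ∀ {P k p q} d n → ∣ proj₁ d ∣ ℕ.+ ∣ proj₂ d ∣ ≡ 1 → along p d n ≡ q →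
                Spans P k → P p → Spans (P ∪ ｛ q ｝) (k + + n)
spans-segment {p = p} d n unit end sp Pp =
  spans-mono (λ { (inj₁ Pr) → inj₁ Pr ; (inj₂ refl) → inj₂ (n , ℕ.≤-refl , end) }) ℤ.≤-refl
    (spans-ray p d unit sp Pp n)

unmoved : ∀ z n → z + + n * 0ℤ ≡ z
unmoved z n = trans (cong (λ t → z + t) (ℤ.*-zeroʳ (+ n))) (ℤ.+-identityʳ z)

axis-walk : ∀ z z' → ∃[ s ] ∣ s ∣ ≡ 1 × z + + ∣ z - z' ∣ * s ≡ z'
axis-walk z z' with ℤ.+∣i∣≡i⊎+∣i∣≡-i (z - z')
... | inj₁ e = -1ℤ , refl , trans (cong (λ t → z + t * -1ℤ) e) (back z z')
  where
    back : ∀ z z' → z + (z - z') * -1ℤ ≡ z'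
    back z z' = solve (z ∷ z' ∷ [])
... | inj₂ e = 1ℤ , refl , trans (cong (λ t → z + t * 1ℤ) e) (forth z z')
  where
    forth : ∀ z z' → z + (- (z - z')) * 1ℤ ≡ z'
    forth z z' = solve (z ∷ z' ∷ [])

spans-attach : ∀ {P k p} → Spans P k → P p → ∀ q → Spans (P ∪ ｛ q ｝) (k + + d₁ p q)
spans-attach {P} {k} {x , y} sp Pp (x' , y') =
  let s , ∣s∣≡1 , x→x' = axis-walk x x'
      t , ∣t∣≡1 , y→y' = axis-walk y y'
      horizontal = spans-segment (s , 0ℤ) ∣ x - x' ∣ (trans (ℕ.+-identityʳ ∣ s ∣) ∣s∣≡1)
                     (cong₂ _,_ x→x' (unmoved y ∣ x - x' ∣)) sp Pp
      vertical   = spans-segment (0ℤ , t) ∣ y - y' ∣ ∣t∣≡1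
                     (cong₂ _,_ (unmoved x' ∣ y - y' ∣) y→y') horizontal (inj₂ refl)
  in spans-mono (λ { (inj₁ Pr) → inj₁ (inj₁ Pr) ; (inj₂ refl) → inj₂ refl }) (ℤ.≤-reflexive (sym cost))
       vertical
  where
    cost : k + + (∣ x - x' ∣ ℕ.+ ∣ y - y' ∣) ≡ k + + ∣ x - x' ∣ + + ∣ y - y' ∣
    cost = trans (cong (λ t → k + t) (ℤ.pos-+ ∣ x - x' ∣ ∣ y - y' ∣)) (sym (ℤ.+-assoc k _ _))

spans-average : ∀ {P k l t} → Spans P k → Spans P l → k + l ≤ t + t → Spans P t
spans-average (V , n , T , P⊆V , n≤k) (V' , n' , T' , P⊆V' , n'≤l) k+l≤t+t with n ℕ.≤? n'
... | yes n≤n' = V , n , T , P⊆V , half-≤ (ℤ.≤-trans (ℤ.+-monoʳ-≤ (+ n) (+≤+ n≤n')) n+n'≤t+t)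
  where n+n'≤t+t = ℤ.≤-trans (ℤ.+-mono-≤ n≤k n'≤l) k+l≤t+t
... | no n≰n'  = V' , n' , T' , P⊆V' ,
                 half-≤ (ℤ.≤-trans (ℤ.+-monoˡ-≤ (+ n') (+≤+ (ℕ.<⇒≤ (ℕ.≰⇒> n≰n')))) n+n'≤t+t)
  where n+n'≤t+t = ℤ.≤-trans (ℤ.+-mono-≤ n≤k n'≤l) k+l≤t+t

spans-tree : ∀ {z₁ z₂ z₃ z₄ k} → Spans (｛ z₁ ｝ ∪ ｛ z₂ ｝ ∪ ｛ z₃ ｝ ∪ ｛ z₄ ｝) k →
             ∃[ n ] TreeThrough z₁ z₂ z₃ z₄ n × + n ≤ k
spans-tree (V , n , T , P⊆V , n≤k) =
  n , (V , T , P⊆V (inj₁ refl) , P⊆V (inj₂ (inj₁ refl)) ,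
       P⊆V (inj₂ (inj₂ (inj₁ refl))) , P⊆V (inj₂ (inj₂ (inj₂ refl)))) , n≤k

module UpperBound (a b c : ℤ) (c+c≤a : c + c ≤ a) where

  Trunk : ℤ → Pred Pt 0ℓ
  Trunk h (x , y) = c ≤ x × x ≤ a - c × y ≡ h

  record Leg (h : ℤ) (z : Pt) (e : ℤ) : Set where
    constructor leg
    field
      foot     : ℤ
      c≤foot   : c ≤ foot
      foot≤a-c : foot ≤ a - c
      length≤e : + d₁ (foot , h) z ≤ e

  c≤a-c : c ≤ a - c
  c≤a-c = ≤-via c+c≤a (solve (a ∷ c ∷ []))

  spans-trunk : ∀ h → Spans (Trunk h) (a - c - c)
  spans-trunk h =
    spans-mono on-ray (ℤ.≤-reflexive trunk-length)
      (spans-ray (c , h) (1ℤ , 0ℤ) refl (spans-singleton (c , h)) refl ∣ a - c - c ∣)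
    where
      trunk-length : + ∣ a - c - c ∣ ≡ a - c - c
      trunk-length = ℤ.0≤i⇒+∣i∣≡i (≤-via c+c≤a (solve (a ∷ c ∷ [])))
      on-ray : Trunk h ⊆ ｛ (c , h) ｝ ∪ Ray (c , h) (1ℤ , 0ℤ) ∣ a - c - c ∣
      on-ray {x , .h} (c≤x , x≤a-c , refl) =
        inj₂ (∣ x - c ∣ , ℤ.drop‿+≤+ offset≤length , cong₂ _,_ reach (unmoved h ∣ x - c ∣))
        where
          offset≤length : + ∣ x - c ∣ ≤ + ∣ a - c - c ∣
          offset≤length = subst₂ _≤_ (sym (+∣j-i∣≡j-i c≤x)) (sym trunk-length)
                                     (≤-via x≤a-c (solve (a ∷ c ∷ x ∷ [])))
          reach : c + + ∣ x - c ∣ * 1ℤ ≡ x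
          reach = trans (cong (λ t → c + t * 1ℤ) (+∣j-i∣≡j-i c≤x)) (solve (c ∷ x ∷ []))

  spans-leg : ∀ {P k h z e} → Spans P k → Trunk h ⊆ P → Leg h z e → Spans (P ∪ ｛ z ｝) (k + e)
  spans-leg {k = k} {z = z} sp trunk⊆P (leg x c≤x x≤a-c d≤e) =
    spans-mono id (ℤ.+-monoʳ-≤ k d≤e) (spans-attach sp (trunk⊆P (c≤x , x≤a-c , refl)) z)

  spans-legs : ∀ {h z₁ z₂ z₃ z₄ e₁ e₂ e₃ e₄} →
               Leg h z₁ e₁ → Leg h z₂ e₂ → Leg h z₃ e₃ → Leg h z₄ e₄ →
               Spans (｛ z₁ ｝ ∪ ｛ z₂ ｝ ∪ ｛ z₃ ｝ ∪ ｛ z₄ ｝) (a - c - c + e₁ + e₂ + e₃ + e₄)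
  spans-legs {h} {z₁} {z₂} {z₃} {z₄} l₁ l₂ l₃ l₄ =
    spans-mono pick ℤ.≤-refl
      (spans-leg (spans-leg (spans-leg (spans-leg (spans-trunk h) id l₁) inj₁ l₂) (inj₁ ∘ inj₁) l₃)
                 (inj₁ ∘ inj₁ ∘ inj₁) l₄)
    where
      pick : ｛ z₁ ｝ ∪ ｛ z₂ ｝ ∪ ｛ z₃ ｝ ∪ ｛ z₄ ｝ ⊆ (((Trunk h ∪ ｛ z₁ ｝) ∪ ｛ z₂ ｝) ∪ ｛ z₃ ｝) ∪ ｛ z₄ ｝
      pick (inj₁ refl)                 = inj₁ (inj₁ (inj₁ (inj₂ refl)))
      pick (inj₂ (inj₁ refl))          = inj₁ (inj₁ (inj₂ refl))
      pick (inj₂ (inj₂ (inj₁ refl)))   = inj₁ (inj₂ refl)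
      pick (inj₂ (inj₂ (inj₂ refl)))   = inj₂ refl

  clamp-cases : ∀ x → x ≤ c ⊎ (c ≤ x × x ≤ a - c) ⊎ a - c ≤ x
  clamp-cases x with x ≤? c | x ≤? a - c
  ... | yes x≤c | _         = inj₁ x≤c
  ... | no x≰c  | yes x≤a-c = inj₂ (inj₁ (ℤ.<⇒≤ (ℤ.≰⇒> x≰c) , x≤a-c))
  ... | no _    | no x≰a-c  = inj₂ (inj₂ (ℤ.<⇒≤ (ℤ.≰⇒> x≰a-c)))

  leg-cost : ∀ x₀ h {x y u v e} → + ∣ x₀ - x ∣ ≡ u → + ∣ h - y ∣ ≡ v → u + v ≤ e →
             + d₁ (x₀ , h) (x , y) ≤ e
  leg-cost x₀ h {x} {y} ∣x₀-x∣≡u ∣h-y∣≡v =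
    subst (_≤ _) (sym (trans (ℤ.pos-+ ∣ x₀ - x ∣ ∣ h - y ∣) (cong₂ _+_ ∣x₀-x∣≡u ∣h-y∣≡v)))

  leg-below : ∀ {h x y} → InO a b c (x , y) → y ≤ h → Leg h (x , y) h
  leg-below {h} {x} {y} (_ , _ , 0≤y , _ , c≤x+y , _ , _ , x-y≤a-c) y≤h with clamp-cases x
  ... | inj₁ x≤c =
    leg c ℤ.≤-refl c≤a-c
      (leg-cost c h (+∣j-i∣≡j-i x≤c) (+∣j-i∣≡j-i y≤h) (≤-via c≤x+y (solve (c ∷ h ∷ x ∷ y ∷ []))))
  ... | inj₂ (inj₁ (c≤x , x≤a-c)) =
    leg x c≤x x≤a-c
      (leg-cost x h (+∣j-i∣≡j-i {x} ℤ.≤-refl) (+∣j-i∣≡j-i y≤h) (≤-via 0≤y (solve (h ∷ x ∷ y ∷ []))))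
  ... | inj₂ (inj₂ a-c≤x) =
    leg (a - c) c≤a-c ℤ.≤-refl
      (leg-cost (a - c) h (+∣i-j∣≡j-i a-c≤x) (+∣j-i∣≡j-i y≤h)
                (≤-via x-y≤a-c (solve (a ∷ c ∷ h ∷ x ∷ y ∷ []))))

  leg-above : ∀ {h x y} → InO a b c (x , y) → h ≤ y → Leg h (x , y) (b - h)
  leg-above {h} {x} {y} (_ , _ , _ , y≤b , _ , x+y≤a+b-c , c-b≤x-y , _) h≤y with clamp-cases x
  ... | inj₁ x≤c =
    leg c ℤ.≤-refl c≤a-c
      (leg-cost c h (+∣j-i∣≡j-i x≤c) (+∣i-j∣≡j-i h≤y) (≤-via c-b≤x-y (solve (b ∷ c ∷ h ∷ x ∷ y ∷ []))))
  ... | inj₂ (inj₁ (c≤x , x≤a-c)) =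
    leg x c≤x x≤a-c
      (leg-cost x h (+∣j-i∣≡j-i {x} ℤ.≤-refl) (+∣i-j∣≡j-i h≤y) (≤-via y≤b (solve (b ∷ h ∷ x ∷ y ∷ []))))
  ... | inj₂ (inj₂ a-c≤x) =
    leg (a - c) c≤a-c ℤ.≤-refl
      (leg-cost (a - c) h (+∣i-j∣≡j-i a-c≤x) (+∣i-j∣≡j-i h≤y)
                (≤-via x+y≤a+b-c (solve (a ∷ b ∷ c ∷ h ∷ x ∷ y ∷ []))))

  leg-pair : ∀ h {z} → InO a b c z → h + h ≤ b → b ≤ h + h + 1ℤ →
             ∃[ e ] Leg h z e × Leg (b - h) z (b - e)
  leg-pair h {x , y} z∈O h+h≤b b≤h+h+1 with y ≤? h
  ... | yes y≤h =
    h , leg-below z∈O y≤h , leg-below {b - h} z∈O (ℤ.≤-trans y≤h (≤-via h+h≤b (solve (b ∷ h ∷ []))))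
  ... | no y≰h =
    b - h , leg-above z∈O (ℤ.<⇒≤ (ℤ.≰⇒> y≰h)) ,
    leg-above {b - h} z∈O (≤-via (ℤ.+-mono-≤ b≤h+h+1 1+h≤y) (solve (b ∷ h ∷ y ∷ [])))
    where
      1+h≤y : 1ℤ + h ≤ y
      1+h≤y = ℤ.i<j⇒suc[i]≤j (ℤ.≰⇒> y≰h)

  spans-octagon : ∀ {z₁ z₂ z₃ z₄} → InO a b c z₁ → InO a b c z₂ → InO a b c z₃ → InO a b c z₄ →
                  Spans (｛ z₁ ｝ ∪ ｛ z₂ ｝ ∪ ｛ z₃ ｝ ∪ ｛ z₄ ｝) ((a + + 2 * b) - + 2 * c)
  spans-octagon z₁∈O z₂∈O z₃∈O z₄∈O =
    let h , h+h≤b , b≤h+h+1 = halving b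
        e₁ , l₁ , l₁' = leg-pair h z₁∈O h+h≤b b≤h+h+1
        e₂ , l₂ , l₂' = leg-pair h z₂∈O h+h≤b b≤h+h+1
        e₃ , l₃ , l₃' = leg-pair h z₃∈O h+h≤b b≤h+h+1
        e₄ , l₄ , l₄' = leg-pair h z₄∈O h+h≤b b≤h+h+1
    in spans-average (spans-legs l₁ l₂ l₃ l₄) (spans-legs l₁' l₂' l₃' l₄')
                     (ℤ.≤-reflexive (total e₁ e₂ e₃ e₄))
    where
      total : ∀ e₁ e₂ e₃ e₄ →
        (a - c - c + e₁ + e₂ + e₃ + e₄) + (a - c - c + (b - e₁) + (b - e₂) + (b - e₃) + (b - e₄))
        ≡ ((a + + 2 * b) - + 2 * c) + ((a + + 2 * b) - + 2 * c)
      total e₁ e₂ e₃ e₄ = solve (a ∷ b ∷ c ∷ e₁ ∷ e₂ ∷ e₃ ∷ e₄ ∷ [])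

  quadristance-≤ : ∀ {z₁ z₂ z₃ z₄ m} → InO a b c z₁ → InO a b c z₂ → InO a b c z₃ → InO a b c z₄ →
                   IsQuadristance z₁ z₂ z₃ z₄ m → + m ≤ (a + + 2 * b) - + 2 * c
  quadristance-≤ z₁∈O z₂∈O z₃∈O z₄∈O (_ , minimal) =
    let n , tree , n≤bound = spans-tree (spans-octagon z₁∈O z₂∈O z₃∈O z₄∈O)
    in ℤ.≤-trans (+≤+ (minimal n tree)) n≤bound

module _ {C : Set} {{decEq : IsDecEquivalence {A = C} _≡_}} where

  open IsDecEquivalence decEq using (_≟_)
  open Data.List.Relation.Unary.All using ([]; _∷_)
  open Data.List.Relation.Unary.AllPairs using ([]; _∷_)

  differ : C → C → ℕ
  differ x y = if does (x ≟ y) then 0 else 1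

  differ-≡ : ∀ {x y} → x ≡ y → differ x y ≡ 0
  differ-≡ {x} {y} x≡y with x ≟ y
  ... | yes _   = refl
  ... | no x≢y = ⊥-elim (x≢y x≡y)

  differ-≢ : ∀ {x y} → x ≢ y → differ x y ≡ 1
  differ-≢ {x} {y} x≢y with x ≟ y
  ... | yes x≡y = ⊥-elim (x≢y x≡y)
  ... | no _    = refl

  differ≤1 : ∀ x y → differ x y ℕ.≤ 1
  differ≤1 x y with x ≟ y
  ... | yes _ = z≤n
  ... | no _  = ℕ.≤-refl

  cut : ∀ {V n} → (Pt → C) → GridTree V n → ℕ
  cut col (single _)         = 0
  cut col (grow u w _ _ _ T) = differ (col u) (col w) ℕ.+ cut col T

  unique-constant : ∀ {cs : List C} {x} → Unique cs → All (_≡ x) cs → length cs ℕ.≤ 1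
  unique-constant []                 _                  = z≤n
  unique-constant (_ ∷ [])           _                  = ℕ.≤-refl
  unique-constant ((y≢y' ∷ _) ∷ _) (y≡x ∷ y'≡x ∷ _) = ⊥-elim (y≢y' (trans y≡x (sym y'≡x)))

  unique-remove : ∀ {cs : List C} x → Unique cs → length cs ℕ.≤ suc (length (filter (λ c → ¬? (c ≟ x)) cs))
  unique-remove x [] = z≤n
  unique-remove {y ∷ ys} x (y≢ys ∷ unique) = by-cases (y ≟ x)
    where
      keep? = λ c → ¬? (c ≟ x)
      by-cases : Dec (y ≡ x) → length (y ∷ ys) ℕ.≤ suc (length (filter keep? (y ∷ ys)))
      by-cases (yes y≡x) =
        subst (λ l → length (y ∷ ys) ℕ.≤ suc (length l)) (sym (trans rejected kept)) ℕ.≤-refl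
        where
          rejected = filter-reject keep? (λ y≢x → y≢x y≡x)
          kept     = filter-all keep? (All.map (λ y≢c c≡x → y≢c (trans y≡x (sym c≡x))) y≢ys)
      by-cases (no y≢x) =
        subst (λ l → length (y ∷ ys) ℕ.≤ suc (length l)) (sym (filter-accept keep? y≢x))
              (s≤s (unique-remove x unique))

  colours≤1+cut : ∀ {V n} {cs : List C} (col : Pt → C) (T : GridTree V n) →
                  Unique cs → All (_∈ map col V) cs → length cs ℕ.≤ suc (cut col T)
  colours≤1+cut col (single v) unique cs∈ = unique-constant unique (All.map (λ { (here c≡) → c≡ }) cs∈)
  colours≤1+cut {cs = cs} col (grow {V} u w u∈V _ _ T) unique cs∈ = by-cases (col u ≟ col w)
    where
      by-cases : Dec (col u ≡ col w) → length cs ℕ.≤ suc (differ (col u) (col w) ℕ.+ cut col T)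
      by-cases (yes cu≡cw) =
        subst (λ d → length cs ℕ.≤ suc (d ℕ.+ cut col T)) (sym (differ-≡ cu≡cw))
          (colours≤1+cut col T unique (All.map old-colour cs∈))
        where
          old-colour : ∀ {c} → c ∈ map col (w ∷ V) → c ∈ map col V
          old-colour (here refl) = subst (_∈ map col V) cu≡cw (∈-map⁺ col u∈V)
          old-colour (there c∈)  = c∈
      by-cases (no cu≢cw) =
        subst (λ d → length cs ℕ.≤ suc (d ℕ.+ cut col T)) (sym (differ-≢ cu≢cw))
          (ℕ.≤-trans (unique-remove (col w) unique)
            (s≤s (colours≤1+cut col T (Unique.filter⁺ new? unique)
                   (All.zipWith old-colour (All.all-filter new? cs , All.filter⁺ new? cs∈)))))
        where
          new? = λ c → ¬? (c ≟ col w)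
          old-colour : ∀ {c} → (c ≢ col w) × c ∈ map col (w ∷ V) → c ∈ map col V
          old-colour (c≢cw , here c≡cw) = ⊥-elim (c≢cw c≡cw)
          old-colour (_ , there c∈)     = c∈

  cut-separates : ∀ {V n p q} (col : Pt → C) (T : GridTree V n) → p ∈ V → q ∈ V → col p ≢ col q →
                  1 ℕ.≤ cut col T
  cut-separates col T p∈V q∈V cp≢cq =
    ℕ.s≤s⁻¹ (colours≤1+cut col T ((cp≢cq ∷ []) ∷ [] ∷ []) (∈-map⁺ col p∈V ∷ ∈-map⁺ col q∈V ∷ []))

module _ {C D : Set} {{decC : IsDecEquivalence {A = C} _≡_}} {{decD : IsDecEquivalence {A = D} _≡_}} where

  open IsDecEquivalence decC using () renaming (_≟_ to _≟ᶜ_)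
  open IsDecEquivalence decD using () renaming (_≟_ to _≟ᴰ_)

  differ-× : ∀ (x x' : C) (y y' : D) → differ (x , y) (x' , y') ℕ.≤ differ x x' ℕ.+ differ y y'
  differ-× x x' y y' = by-cases (x ≟ᶜ x') (y ≟ᴰ y')
    where
      by-cases : Dec (x ≡ x') → Dec (y ≡ y') → differ (x , y) (x' , y') ℕ.≤ differ x x' ℕ.+ differ y y'
      by-cases (yes x≡x') (yes y≡y') = subst (ℕ._≤ _) (sym (differ-≡ (cong₂ _,_ x≡x' y≡y'))) z≤n
      by-cases (no x≢x') _ =
        subst (λ d → differ (x , y) (x' , y') ℕ.≤ d ℕ.+ differ y y') (sym (differ-≢ x≢x'))
              (ℕ.≤-trans (differ≤1 (x , y) (x' , y')) (ℕ.m≤m+n 1 _))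
      by-cases _ (no y≢y') =
        subst (λ d → differ (x , y) (x' , y') ℕ.≤ differ x x' ℕ.+ d) (sym (differ-≢ y≢y'))
              (ℕ.≤-trans (differ≤1 (x , y) (x' , y')) (ℕ.m≤n+m 1 _))

  cut-× : ∀ {V n} (f : Pt → C) (g : Pt → D) (T : GridTree V n) →
          cut (λ p → f p , g p) T ℕ.≤ cut f T ℕ.+ cut g T
  cut-× f g (single _)         = z≤n
  cut-× f g (grow u w _ _ _ T) =
    ℕ.≤-trans (ℕ.+-mono-≤ (differ-× (f u) (f w) (g u) (g w)) (cut-× f g T))
              (ℕ.≤-reflexive (+-interchange (differ (f u) (f w)) (differ (g u) (g w)) (cut f T) (cut g T)))

∑< : ℕ → (ℕ → ℕ) → ℕ
∑< zero    f = 0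
∑< (suc n) f = ∑< n f ℕ.+ f n

syntax ∑< n (λ i → e) = ∑[ i < n ] e

∑-+ : ∀ n f g → ∑[ i < n ] (f i ℕ.+ g i) ≡ ∑< n f ℕ.+ ∑< n g
∑-+ zero    f g = refl
∑-+ (suc n) f g =
  trans (cong (ℕ._+ (f n ℕ.+ g n)) (∑-+ n f g)) (+-interchange (∑< n f) (∑< n g) (f n) (g n))

∑-zero : ∀ n f → (∀ i → i ℕ.< n → f i ≡ 0) → ∑< n f ≡ 0
∑-zero zero    f _     = refl
∑-zero (suc n) f zeros = cong₂ ℕ._+_ (∑-zero n f (λ i i<n → zeros i (ℕ.m<n⇒m<1+n i<n))) (zeros n ℕ.≤-refl)

∑-≤1 : ∀ n f → (∀ i → f i ℕ.≤ 1) → (∀ i j → 0 ℕ.< f i → 0 ℕ.< f j → i ≡ j) → ∑< n f ℕ.≤ 1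
∑-≤1 zero    f _   _   = z≤n
∑-≤1 (suc n) f f≤1 one with f n in fn
... | zero  = subst (ℕ._≤ 1) (sym (ℕ.+-identityʳ (∑< n f))) (∑-≤1 n f f≤1 one)
... | suc k = subst (λ s → s ℕ.+ suc k ℕ.≤ 1) (sym (∑-zero n f vanish)) (subst (ℕ._≤ 1) fn (f≤1 n))
  where
    vanish : ∀ i → i ℕ.< n → f i ≡ 0
    vanish i i<n with f i in fi
    ... | zero  = refl
    ... | suc _ = ⊥-elim (ℕ.<-irrefl (one i n (subst (0 ℕ.<_) (sym fi) (s≤s z≤n))
                                                (subst (0 ℕ.<_) (sym fn) (s≤s z≤n))) i<n)

∑-split : ∀ m n f → ∑< (m ℕ.+ n) f ≡ ∑< m f ℕ.+ ∑[ i < n ] f (m ℕ.+ i)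
∑-split m zero    f = trans (cong (λ k → ∑< k f) (ℕ.+-identityʳ m)) (sym (ℕ.+-identityʳ (∑< m f)))
∑-split m (suc n) f =
  trans (cong (λ k → ∑< k f) (ℕ.+-suc m n))
        (trans (cong (ℕ._+ f (m ℕ.+ n)) (∑-split m n f)) (ℕ.+-assoc (∑< m f) _ _))

∑-≥ : ∀ n f k → (∀ i → i ℕ.< n → k ℕ.≤ f i) → n ℕ.* k ℕ.≤ ∑< n f
∑-≥ zero    f k _  = z≤n
∑-≥ (suc n) f k k≤ =
  subst (ℕ._≤ ∑< (suc n) f) (ℕ.+-comm (n ℕ.* k) k)
        (ℕ.+-mono-≤ (∑-≥ n f k (λ i i<n → k≤ i (ℕ.m<n⇒m<1+n i<n))) (k≤ n ℕ.≤-refl))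

∑-≥-length : ∀ n f → (∀ i → i ℕ.< n → 1 ℕ.≤ f i) → n ℕ.≤ ∑< n f
∑-≥-length n f 1≤ = subst (ℕ._≤ ∑< n f) (ℕ.*-identityʳ n) (∑-≥ n f 1 1≤)

∑-bulge : ∀ C M f → (∀ i → i ℕ.< C ℕ.+ (M ℕ.+ C) → 1 ℕ.≤ f i) → (∀ i → i ℕ.< M → 2 ℕ.≤ f (C ℕ.+ i)) →
          C ℕ.+ (M ℕ.+ C) ℕ.+ M ℕ.≤ ∑< (C ℕ.+ (M ℕ.+ C)) f
∑-bulge C M f 1≤ 2≤ =
  subst₂ ℕ._≤_ (count C M) (sym split)
    (ℕ.+-mono-≤ (∑-≥ C f 1 (λ i i<C → 1≤ i (ℕ.≤-trans i<C (ℕ.m≤m+n C _))))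
      (ℕ.+-mono-≤ (∑-≥ M (λ i → f (C ℕ.+ i)) 2 2≤)
                  (∑-≥ C (λ i → f (C ℕ.+ (M ℕ.+ i))) 1 (λ i i<C → 1≤ _ (ℕ.+-monoʳ-< C (ℕ.+-monoʳ-< M i<C))))))
  where
    split = trans (∑-split C (M ℕ.+ C) f) (cong (∑< C f ℕ.+_) (∑-split M C (λ i → f (C ℕ.+ i))))
    count : ∀ C M → C ℕ.* 1 ℕ.+ (M ℕ.* 2 ℕ.+ C ℕ.* 1) ≡ C ℕ.+ (M ℕ.+ C) ℕ.+ M
    count = ℕ-Solver.solve-∀

-- left k p says whether p lies to the left of the vertical line x = k + ½.
left : ℤ → Pt → Bool
left k (x , _) = does (x ≤? k)

below : ℤ → Pt → Bool
below k (_ , y) = does (y ≤? k)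

left-of : ∀ k p → proj₁ p ≤ k → left k p ≡ true
left-of k (x , _) x≤k = dec-true (x ≤? k) x≤k

right-of : ∀ k p → k < proj₁ p → left k p ≡ false
right-of k (x , _) k<x = dec-false (x ≤? k) (ℤ.<⇒≱ k<x)

below-of : ∀ k p → proj₂ p ≤ k → below k p ≡ true
below-of k (_ , y) y≤k = dec-true (y ≤? k) y≤k

above-of : ∀ k p → k < proj₂ p → below k p ≡ false
above-of k (_ , y) k<y = dec-false (y ≤? k) (ℤ.<⇒≱ k<y)

true≢false : ∀ {b b' : Bool} → b ≡ true → b' ≡ false → b ≢ b'
true≢false refl refl ()

crosses : ℤ → ℤ → ℤ → ℕ
crosses k x x' = differ (does (x ≤? k)) (does (x' ≤? k))

unit-gap : ∀ {x k x'} → x ≤ k → k < x' → ∣ x - x' ∣ ≡ 1 → k ≡ x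
unit-gap {x} {k} {x'} x≤k k<x' ∣x-x'∣≡1 = ℤ.≤-antisym k≤x x≤k
  where
    x'-x≡1 : x' - x ≡ 1ℤ
    x'-x≡1 = trans (sym (+∣i-j∣≡j-i (ℤ.≤-trans x≤k (ℤ.<⇒≤ k<x')))) (cong +_ ∣x-x'∣≡1)
    1+k≤x' : 1ℤ + k ≤ x'
    1+k≤x' = ℤ.i<j⇒suc[i]≤j k<x'
    k≤x : k ≤ x
    k≤x = ≤-via (ℤ.+-mono-≤ 1+k≤x' (ℤ.≤-reflexive x'-x≡1)) (solve (k ∷ x ∷ x' ∷ []))

crossing-point : ∀ {x x' k} → ∣ x - x' ∣ ≡ 1 → 0 ℕ.< crosses k x x' → k ≡ x ⊓ x'
crossing-point {x} {x'} {k} ∣x-x'∣≡1 = by-cases (x ≤? k) (x' ≤? k)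
  where
    by-cases : (l : Dec (x ≤ k)) (l' : Dec (x' ≤ k)) → 0 ℕ.< differ (does l) (does l') → k ≡ x ⊓ x'
    by-cases (yes x≤k) (no x'≰k) _ =
      trans (unit-gap x≤k k<x' ∣x-x'∣≡1) (sym (ℤ.i≤j⇒i⊓j≡i (ℤ.≤-trans x≤k (ℤ.<⇒≤ k<x'))))
      where k<x' = ℤ.≰⇒> x'≰k
    by-cases (no x≰k) (yes x'≤k) _ =
      trans (unit-gap x'≤k k<x (trans (ℤ.∣i-j∣≡∣j-i∣ x' x) ∣x-x'∣≡1))
            (sym (ℤ.i≥j⇒i⊓j≡j (ℤ.≤-trans x'≤k (ℤ.<⇒≤ k<x))))
      where k<x = ℤ.≰⇒> x≰k
    by-cases (yes _) (yes _) ()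
    by-cases (no _)  (no _)  ()

crossings-unit : ∀ N {x x'} → ∣ x - x' ∣ ≡ 1 → ∑[ i < N ] crosses (+ i) x x' ℕ.≤ 1
crossings-unit N {x} {x'} ∣x-x'∣≡1 =
  ∑-≤1 N (λ i → crosses (+ i) x x') (λ i → differ≤1 (does (x ≤? + i)) (does (x' ≤? + i)))
    (λ i j crosses-i crosses-j → ℤ.+-injective (trans (crossing-point {x} {x'} ∣x-x'∣≡1 crosses-i)
                                                    (sym (crossing-point {x} {x'} ∣x-x'∣≡1 crosses-j))))

crossings-none : ∀ N {x x'} → ∣ x - x' ∣ ≡ 0 → ∑[ i < N ] crosses (+ i) x x' ≡ 0
crossings-none N {x} {x'} ∣x-x'∣≡0 =
  ∑-zero N (λ i → crosses (+ i) x x')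
    (λ i _ → differ-≡ (cong (λ z → does (z ≤? + i)) (ℤ.i-j≡0⇒i≡j x x' (ℤ.∣i∣≡0⇒i≡0 ∣x-x'∣≡0))))

edge-crossings : ∀ A B {u w} → Adj u w →
  ∑[ i < A ] differ (left (+ i) u) (left (+ i) w) ℕ.+ ∑[ j < B ] differ (below (+ j) u) (below (+ j) w) ℕ.≤ 1
edge-crossings A B {xu , yu} {xw , yw} adj = by-cases ∣ xu - xw ∣ ∣ yu - yw ∣ refl refl adj
  where
    by-cases : ∀ m n → ∣ xu - xw ∣ ≡ m → ∣ yu - yw ∣ ≡ n → m ℕ.+ n ≡ 1 →
               ∑[ i < A ] crosses (+ i) xu xw ℕ.+ ∑[ j < B ] crosses (+ j) yu yw ℕ.≤ 1
    by-cases 0 1 ex ey _ =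
      subst (λ s → s ℕ.+ _ ℕ.≤ 1) (sym (crossings-none A {xu} {xw} ex)) (crossings-unit B {yu} {yw} ey)
    by-cases 1 0 ex ey _ =
      subst (λ s → _ ℕ.+ s ℕ.≤ 1) (sym (crossings-none B {yu} {yw} ey))
            (subst (ℕ._≤ 1) (sym (ℕ.+-identityʳ _)) (crossings-unit A {xu} {xw} ex))
    by-cases 0             0             _ _ ()
    by-cases 0             (suc (suc _)) _ _ ()
    by-cases 1             (suc _)       _ _ ()
    by-cases (suc (suc _)) _             _ _ ()

crossings≤edges : ∀ A B {V n} (T : GridTree V n) →
  ∑[ i < A ] cut (left (+ i)) T ℕ.+ ∑[ j < B ] cut (below (+ j)) T ℕ.≤ n
crossings≤edges A B (single _) =
  ℕ.≤-reflexive (cong₂ ℕ._+_ (∑-zero A (λ _ → 0) (λ _ _ → refl)) (∑-zero B (λ _ → 0) (λ _ _ → refl)))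
crossings≤edges A B {n = suc n} (grow u w _ _ adj T) =
  subst (ℕ._≤ suc n) (sym (trans (cong₂ ℕ._+_ (∑-+ A dV cV) (∑-+ B dH cH))
                                 (+-interchange (∑< A dV) (∑< A cV) (∑< B dH) (∑< B cH))))
        (ℕ.+-mono-≤ (edge-crossings A B {u} {w} adj) (crossings≤edges A B T))
  where
    dV cV dH cH : ℕ → ℕ
    dV i = differ (left (+ i) u) (left (+ i) w)
    cV i = cut (left (+ i)) T
    dH j = differ (below (+ j) u) (below (+ j) w)
    cH j = cut (below (+ j)) T

pinwheel-in-octagon : ∀ c ma mb → 0ℤ ≤ c → 0ℤ ≤ ma → 0ℤ ≤ mb →
  let a = c + (ma + c) ; b = c + (mb + c) in
  InO a b c (0ℤ , c) × InO a b c (c , b) × InO a b c (a , c + mb) × InO a b c (c + ma , 0ℤ)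
pinwheel-in-octagon c ma mb 0≤c 0≤ma 0≤mb =
  (ℤ.≤-refl , 0≤a , 0≤c , ≤-via 0≤mb+c (solve vars) , ≤-via (ℤ.≤-refl {c}) (solve vars) ,
   ≤-via (ℤ.+-mono-≤ 0≤a 0≤mb) (solve vars) , ≤-via 0≤mb (solve vars) , ≤-via 0≤a (solve vars)) ,
  (0≤c , ≤-via 0≤ma+c (solve vars) , 0≤b , ℤ.≤-refl , ≤-via 0≤b (solve vars) ,
   ≤-via 0≤ma (solve vars) , ℤ.≤-refl , ≤-via (ℤ.+-mono-≤ 0≤ma 0≤b) (solve vars)) ,
  (0≤a , ℤ.≤-refl , ℤ.+-mono-≤ 0≤c 0≤mb , ≤-via 0≤c (solve vars) , ≤-via (ℤ.+-mono-≤ 0≤a 0≤mb) (solve vars) ,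
   ≤-via (ℤ.≤-refl {c}) (solve vars) , ≤-via 0≤a (solve vars) , ≤-via 0≤mb (solve vars)) ,
  (ℤ.+-mono-≤ 0≤c 0≤ma , ≤-via 0≤c (solve vars) , ℤ.≤-refl , 0≤b , ≤-via 0≤ma (solve vars) ,
   ≤-via 0≤b (solve vars) , ≤-via (ℤ.+-mono-≤ 0≤ma 0≤b) (solve vars) , ≤-via (ℤ.≤-refl {c}) (solve vars))
  where
    vars = c ∷ ma ∷ mb ∷ []
    0≤ma+c = ℤ.+-mono-≤ 0≤ma 0≤c
    0≤mb+c = ℤ.+-mono-≤ 0≤mb 0≤c
    0≤a = ℤ.+-mono-≤ 0≤c 0≤ma+c
    0≤b = ℤ.+-mono-≤ 0≤c 0≤mb+c

module Pinwheel (C MA MB : ℕ) where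

  A B : ℕ
  A = C ℕ.+ (MA ℕ.+ C)
  B = C ℕ.+ (MB ℕ.+ C)

  P₁ P₂ P₃ P₄ : Pt
  P₁ = (+ 0 , + C)
  P₂ = (+ C , + B)
  P₃ = (+ A , + (C ℕ.+ MB))
  P₄ = (+ (C ℕ.+ MA) , + 0)

  module _ {V n} (T : GridTree V n) (P₁∈V : P₁ ∈ V) (P₂∈V : P₂ ∈ V) (P₃∈V : P₃ ∈ V) (P₄∈V : P₄ ∈ V) where

    open Data.List.Relation.Unary.All using ([]; _∷_)
    open Data.List.Relation.Unary.AllPairs using ([]; _∷_)

    vertical-cut : ∀ i → i ℕ.< A → 1 ℕ.≤ cut (left (+ i)) T
    vertical-cut i i<A =
      cut-separates (left (+ i)) T P₁∈V P₃∈V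
        (true≢false (left-of (+ i) P₁ (+≤+ z≤n)) (right-of (+ i) P₃ (+<+ i<A)))

    horizontal-cut : ∀ j → j ℕ.< B → 1 ℕ.≤ cut (below (+ j)) T
    horizontal-cut j j<B =
      cut-separates (below (+ j)) T P₄∈V P₂∈V
        (true≢false (below-of (+ j) P₄ (+≤+ z≤n)) (above-of (+ j) P₂ (+<+ j<B)))

    quadrant-cut : ∀ i j → i ℕ.< MA → j ℕ.< MB →
                   3 ℕ.≤ cut (left (+ (C ℕ.+ i))) T ℕ.+ cut (below (+ (C ℕ.+ j))) T
    quadrant-cut i j i<MA j<MB =
      ℕ.≤-trans (ℕ.s≤s⁻¹ (colours≤1+cut quadrant T distinct present)) (cut-× (left k) (below l) T)
      where
        k l : ℤ
        k = + (C ℕ.+ i)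
        l = + (C ℕ.+ j)
        quadrant : Pt → Bool × Bool
        quadrant p = left k p , below l p
        distinct : Unique ((true , true) ∷ (true , false) ∷ (false , false) ∷ (false , true) ∷ [])
        distinct = ((λ ()) ∷ (λ ()) ∷ (λ ()) ∷ []) ∷ ((λ ()) ∷ (λ ()) ∷ []) ∷ ((λ ()) ∷ []) ∷ [] ∷ []
        seen : ∀ {p q} → p ∈ V → quadrant p ≡ q → q ∈ map quadrant V
        seen p∈V refl = ∈-map⁺ quadrant p∈V
        present = seen P₁∈V (cong₂ _,_ (left-of k P₁ (+≤+ z≤n)) (below-of l P₁ (+≤+ (ℕ.m≤m+n C j))))
                ∷ seen P₂∈V (cong₂ _,_ (left-of k P₂ (+≤+ (ℕ.m≤m+n C i)))
                                       (above-of l P₂ (+<+ (ℕ.+-monoʳ-< C (ℕ.≤-trans j<MB (ℕ.m≤m+n MB C))))))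
                ∷ seen P₃∈V (cong₂ _,_ (right-of k P₃ (+<+ (ℕ.+-monoʳ-< C (ℕ.≤-trans i<MA (ℕ.m≤m+n MA C)))))
                                       (above-of l P₃ (+<+ (ℕ.+-monoʳ-< C j<MB))))
                ∷ seen P₄∈V (cong₂ _,_ (right-of k P₄ (+<+ (ℕ.+-monoʳ-< C i<MA))) (below-of l P₄ (+≤+ z≤n)))
                ∷ []

    edges-≥ : MB ℕ.≤ MA → A ℕ.+ B ℕ.+ MB ℕ.≤ n
    edges-≥ MB≤MA =
      ℕ.≤-trans (by-cases (ℕ.anyUpTo? (λ i → cv (C ℕ.+ i) ℕ.≤? 1) MA)) (crossings≤edges A B T)
      where
        cv ch : ℕ → ℕ
        cv i = cut (left (+ i)) T
        ch j = cut (below (+ j)) T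
        by-cases : Dec (∃[ i ] i ℕ.< MA × cv (C ℕ.+ i) ℕ.≤ 1) → A ℕ.+ B ℕ.+ MB ℕ.≤ ∑< A cv ℕ.+ ∑< B ch
        by-cases (yes (i₀ , i₀<MA , thin)) =
          subst (ℕ._≤ ∑< A cv ℕ.+ ∑< B ch) (sym (ℕ.+-assoc A B MB))
            (ℕ.+-mono-≤ (∑-≥-length A cv vertical-cut) (∑-bulge C MB ch horizontal-cut thick))
          where
            thick : ∀ j → j ℕ.< MB → 2 ℕ.≤ ch (C ℕ.+ j)
            thick j j<MB =
              ℕ.s≤s⁻¹ (ℕ.≤-trans (quadrant-cut i₀ j i₀<MA j<MB) (ℕ.+-monoˡ-≤ (ch (C ℕ.+ j)) thin))
        by-cases (no no-thin) =
          ℕ.≤-trans (ℕ.≤-reflexive (swap A B MB))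
            (ℕ.≤-trans (ℕ.+-monoˡ-≤ B (ℕ.+-monoʳ-≤ A MB≤MA))
              (ℕ.+-mono-≤ (∑-bulge C MA cv vertical-cut thick) (∑-≥-length B ch horizontal-cut)))
          where
            thick : ∀ i → i ℕ.< MA → 2 ℕ.≤ cv (C ℕ.+ i)
            thick i i<MA = ℕ.≰⇒> (λ thin → no-thin (i , i<MA , thin))
            swap : ∀ a b m → a ℕ.+ b ℕ.+ m ≡ a ℕ.+ m ℕ.+ b
            swap = ℕ-Solver.solve-∀

  pinwheel∈O : InO (+ A) (+ B) (+ C) P₁ × InO (+ A) (+ B) (+ C) P₂ ×
               InO (+ A) (+ B) (+ C) P₃ × InO (+ A) (+ B) (+ C) P₄
  pinwheel∈O = pinwheel-in-octagon (+ C) (+ MA) (+ MB) (+≤+ z≤n) (+≤+ z≤n) (+≤+ z≤n)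

  pinwheel-bound : + (A ℕ.+ B ℕ.+ MB) ≡ (+ A + + 2 * + B) - + 2 * + C
  pinwheel-bound = shape (+ C) (+ MA) (+ MB)
    where
      shape : ∀ c ma mb →
              c + (ma + c) + (c + (mb + c)) + mb ≡ (c + (ma + c) + + 2 * (c + (mb + c))) - + 2 * c
      shape c ma mb = solve (c ∷ ma ∷ mb ∷ [])

  pinwheel-quadristance : MB ℕ.≤ MA → IsQuadristance P₁ P₂ P₃ P₄ (A ℕ.+ B ℕ.+ MB)
  pinwheel-quadristance MB≤MA =
    let P₁∈O , P₂∈O , P₃∈O , P₄∈O = pinwheel∈O
        n , (V , T , P₁∈V , P₂∈V , P₃∈V , P₄∈V) , n≤ =
          spans-tree (UpperBound.spans-octagon (+ A) (+ B) (+ C) c+c≤a P₁∈O P₂∈O P₃∈O P₄∈O)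
        n≡ : n ≡ A ℕ.+ B ℕ.+ MB
        n≡ = ℕ.≤-antisym (ℤ.drop‿+≤+ (subst (+ n ≤_) (sym pinwheel-bound) n≤))
                         (edges-≥ T P₁∈V P₂∈V P₃∈V P₄∈V MB≤MA)
    in (V , subst (GridTree V) n≡ T , P₁∈V , P₂∈V , P₃∈V , P₄∈V) ,
       λ _ (_ , T' , P₁∈V' , P₂∈V' , P₃∈V' , P₄∈V') → edges-≥ T' P₁∈V' P₂∈V' P₃∈V' P₄∈V' MB≤MA
    where
      c+c≤a : + C + + C ≤ + A
      c+c≤a = +≤+ (ℕ.+-monoʳ-≤ C (ℕ.m≤n+m C MA))

octagon-shape : ∀ {a b c} → 0ℤ ≤ c → c + c ≤ b → b ≤ a →
  ∃[ C ] ∃[ MA ] ∃[ MB ] MB ℕ.≤ MA × c ≡ + C × b ≡ + (C ℕ.+ (MB ℕ.+ C)) × a ≡ + (C ℕ.+ (MA ℕ.+ C))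
octagon-shape {a} {b} {c} 0≤c c+c≤b b≤a =
  ∣ c ∣ , ∣ a - c - c ∣ , ∣ b - c - c ∣ ,
  ℤ.drop‿+≤+ (subst₂ _≤_ (sym ∣mb∣) (sym ∣ma∣) (≤-via b≤a (solve (a ∷ b ∷ c ∷ [])))) ,
  sym ∣c∣ , sym (rebuild ∣mb∣) , sym (rebuild ∣ma∣)
  where
    ∣c∣ : + ∣ c ∣ ≡ c
    ∣c∣ = ℤ.0≤i⇒+∣i∣≡i 0≤c
    ∣mb∣ : + ∣ b - c - c ∣ ≡ b - c - c
    ∣mb∣ = ℤ.0≤i⇒+∣i∣≡i (≤-via c+c≤b (solve (b ∷ c ∷ [])))
    ∣ma∣ : + ∣ a - c - c ∣ ≡ a - c - c
    ∣ma∣ = ℤ.0≤i⇒+∣i∣≡i (≤-via (ℤ.≤-trans c+c≤b b≤a) (solve (a ∷ c ∷ [])))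
    rebuild : ∀ {s m} → + m ≡ s - c - c → + ∣ c ∣ + (+ m + + ∣ c ∣) ≡ s
    rebuild {s} m≡ = trans (cong₂ (λ u v → u + (v + u)) ∣c∣ m≡) (solve (s ∷ c ∷ []))

tight⇒0≤c : ∀ {a b c} → AllTight a b c → 0ℤ ≤ c
tight⇒0≤c (_ , _ , _ , _ , ((x , y) , (0≤x , _ , 0≤y , _) , x+y≡c) , _) =
  subst (0ℤ ≤_) x+y≡c (ℤ.+-mono-≤ 0≤x 0≤y)

tight⇒c+c≤b : ∀ {a b c} → AllTight a b c → c + c ≤ b
tight⇒c+c≤b {b = b} {c} (((.(+ 0) , y) , (_ , _ , _ , _ , c≤y , _ , c-b≤-y , _) , refl) , _) =
  ≤-via (ℤ.+-mono-≤ c≤y c-b≤-y) (solve (b ∷ c ∷ y ∷ []))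

AttainsBound : ℤ → ℤ → ℤ → Set
AttainsBound a b c = ∃[ z₁ ] ∃[ z₂ ] ∃[ z₃ ] ∃[ z₄ ] ∃[ m ]
  (InO a b c z₁ × InO a b c z₂ × InO a b c z₃ × InO a b c z₄ ×
   IsQuadristance z₁ z₂ z₃ z₄ m × + m ≡ (a + + 2 * b) - + 2 * c)

octagon-attains : ∀ {a b c} → 0ℤ ≤ c → c + c ≤ b → b ≤ a → AttainsBound a b c
octagon-attains 0≤c c+c≤b b≤a with octagon-shape 0≤c c+c≤b b≤a
... | C , MA , MB , MB≤MA , refl , refl , refl =
  let open Pinwheel C MA MB
      P₁∈O , P₂∈O , P₃∈O , P₄∈O = pinwheel∈O
  in P₁ , P₂ , P₃ , P₄ , A ℕ.+ B ℕ.+ MB , P₁∈O , P₂∈O , P₃∈O , P₄∈O ,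
     pinwheel-quadristance MB≤MA , pinwheel-bound

lemma37 : (a b c : ℤ) → b ≤ a → AllTight a b c →
    ((∀ z₁ z₂ z₃ z₄ → InO a b c z₁ → InO a b c z₂ → InO a b c z₃ → InO a b c z₄ →
       ∀ (m : ℕ) → IsQuadristance z₁ z₂ z₃ z₄ m → + m ≤ (a + + 2 * b) - + 2 * c)
    × (∃[ z₁ ] ∃[ z₂ ] ∃[ z₃ ] ∃[ z₄ ] ∃[ m ]
       (InO a b c z₁ × InO a b c z₂ × InO a b c z₃ × InO a b c z₄ ×
        IsQuadristance z₁ z₂ z₃ z₄ m × + m ≡ (a + + 2 * b) - + 2 * c)))
lemma37 a b c b≤a tight =
  (λ _ _ _ _ z₁∈O z₂∈O z₃∈O z₄∈O _ → quadristance-≤ z₁∈O z₂∈O z₃∈O z₄∈O) ,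
  octagon-attains 0≤c c+c≤b b≤a
  where
    0≤c = tight⇒0≤c tight
    c+c≤b = tight⇒c+c≤b tight
    open UpperBound a b c (ℤ.≤-trans c+c≤b b≤a)
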